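{- For every integer $n\ge 2$, the flip graph of $T(2n,2n,2n)$ has at least $4+2^{n+1}$ components consisting of a single vertex.
   Context: Write $Z_k=\{0,1,\dots,k-1\}$. For $N\ge1$, $M\ge2$, $1\le R\le M$, $T(N,M,R)$ is the graph with vertex set $\{v_{i,j}: i\in Z_N, j\in Z_M\}$ (second index modulo $M$) and edges $v_{i,j}v_{i,j+1}$, $v_{i,j}v_{i+1,j}$ ($0\le i\le N-2$), $v_{N-1,j}v_{0,j+R}$, embedded on the torus with faces the 4-cycles $v_{i,j}v_{i,j+1}v_{i+1,j+1}v_{i+1,j}$ ($0\le i\le N-2$) and $v_{N-1,j}v_{N-1,j+1}v_{0,j+R+1}v_{0,j+R}$. (Thus $T(2n,2n,2n)$ is the usual $2n\times 2n$ torus.) The flip graph has as vertices the perfect matchings (domino tilings), two adjacent iff their symmetric difference is the boundary of a face. -}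

module Defs where

open import Data.Nat using (ℕ; zero; suc; _+_; _*_; _<_; _≤_; _<?_; NonZero; s≤s; z≤n; _%_)
open import Data.Nat.DivMod using (m%n<n)
open import Data.Fin using (Fin; toℕ; fromℕ<)
open import Data.Bool using (Bool; true; false; if_then_else_)
open import Data.Product using (_×_; _,_; Σ; ∃; proj₁; proj₂)
open import Data.Sum using (_⊎_)
open import Data.Empty using (⊥)
open import Relation.Nullary using (¬_; does)
open import Relation.Binary.PropositionalEquality using (_≡_; _≢_)

module Torus (N M R : ℕ) .{{_ : NonZero N}} .{{_ : NonZero M}} where

  Vertex : Set
  Vertex = Fin N × Fin M

  rowMod : ℕ → Fin N
  rowMod k = fromℕ< (m%n<n k N)

  colMod : ℕ → Fin M
  colMod k = fromℕ< (m%n<n k M)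

  -- the vertex reached by the "vertical" edge out of v_{i,j}:
  -- v_{i+1,j} if i ≤ N-2, and v_{0,j+R} if i = N-1
  vertNext : Vertex → Vertex
  vertNext (i , j) =
    rowMod (suc (toℕ i)) ,
    (if does (suc (toℕ i) <? N) then j else colMod (toℕ j + R))

  horNext : Vertex → Vertex
  horNext (i , j) = i , colMod (suc (toℕ j))

  -- Edges: (false , v) is the horizontal edge v horNext(v),
  --        (true  , v) is the vertical edge   v vertNext(v).
  -- (Edges are labelled, so T is treated as a multigraph if M = 2.)
  Edge : Set
  Edge = Bool × Vertex

  end₁ : Edge → Vertex
  end₁ (_ , v) = v

  end₂ : Edge → Vertex
  end₂ (false , v) = horNext v
  end₂ (true  , v) = vertNext v

  Incident : Vertex → Edge → Set
  Incident v e = (v ≡ end₁ e) ⊎ (v ≡ end₂ e)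

  EdgeSet : Set
  EdgeSet = Edge → Bool

  IsPerfectMatching : EdgeSet → Set
  IsPerfectMatching m =
    (v : Vertex) →
      (∃ λ e → m e ≡ true × Incident v e) ×
      ((e e′ : Edge) → m e ≡ true → Incident v e →
                       m e′ ≡ true → Incident v e′ → e ≡ e′)

  PerfectMatching : Set
  PerfectMatching = Σ EdgeSet IsPerfectMatching

  -- Faces are indexed by their corner v_{i,j}: the face with boundary
  -- v_{i,j} v_{i,j+1} w_{j+1} w_j where w = vertNext; its four boundary edges.
  Face : Set
  Face = Vertex

  InBoundary : Face → Edge → Set
  InBoundary v e =
    (e ≡ (false , v)) ⊎ (e ≡ (false , vertNext v)) ⊎
    (e ≡ (true , v)) ⊎ (e ≡ (true , horNext v))

  SymDiffIsBoundary : EdgeSet → EdgeSet → Face → Set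
  SymDiffIsBoundary m m′ f =
    (e : Edge) → (m e ≢ m′ e → InBoundary f e) × (InBoundary f e → m e ≢ m′ e)

  FlipAdjacent : PerfectMatching → PerfectMatching → Set
  FlipAdjacent m m′ = ∃ λ (f : Face) → SymDiffIsBoundary (proj₁ m) (proj₁ m′) f

  IsolatedInFlipGraph : PerfectMatching → Set
  IsolatedInFlipGraph m = (m′ : PerfectMatching) → ¬ FlipAdjacent m m′

  Distinct : PerfectMatching → PerfectMatching → Set
  Distinct m m′ = ∃ λ (e : Edge) → proj₁ m e ≢ proj₁ m′ e

2n-nonZero : (n : ℕ) → 2 ≤ n → NonZero (2 * n)
2n-nonZero (suc k) _ = _

-- The 2n antidiagonals i + j ≡ s (mod 2n) of the torus can be paired as {2t, 2t+1} in two
-- ways (offset o = 0 or o = -1), and each of the n pairs of consecutive antidiagonals can be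
-- tiled entirely by horizontal or entirely by vertical dominoes: 2^(n+1) tilings. Along every
-- edge the index i + j changes parity, so no face carries two parallel dominoes, no flip
-- applies, and each tiling is an isolated vertex of the flip graph. The same construction on
-- the diagonals j - i with non-constant labels gives four more isolated tilings; they differ
-- from the antidiagonal ones because those cannot tell apart two vertices of one antidiagonal.
module Submission where

open import Defs
open import Data.Bool using (Bool; true; false; not; _∧_; if_then_else_)
open import Data.Bool.Properties using (not-involutive; not-injective; ¬-not; ∧-conicalˡ; ∧-conicalʳ)
  renaming (_≟_ to _≟ᵇ_)
open import Data.Empty using (⊥; ⊥-elim)
open import Data.Fin using (Fin; toℕ)
open import Data.Fin.Properties using (toℕ-fromℕ<; fromℕ<-cong; fromℕ<-toℕ; toℕ<n)
open import Data.List using (List; []; _∷_; map; _++_; length)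
open import Data.List.Properties using (length-++; length-map)
open import Data.List.Relation.Unary.All as All using (All; []; _∷_)
import Data.List.Relation.Unary.All.Properties as Allₚ
open import Data.List.Relation.Unary.AllPairs as AllPairs using (AllPairs; []; _∷_)
import Data.List.Relation.Unary.AllPairs.Properties as AllPairsₚ
open import Data.Nat using (ℕ; pred; _≡ᵇ_; zero; suc; _+_; _*_; _∸_; _^_; _≤_; _<_; ⌊_/2⌋; NonZero; z≤n; s≤s; _%_)
open import Data.Nat.DivMod using (_mod_; %-distribˡ-+; %-distribˡ-*; m%n<n; m%n%n≡m%n; [m+n]%n≡m%n; m<n⇒m%n≡m; n%n≡0)
open import Data.Nat.Properties
open import Data.Product using (Σ; ∃; _×_; _,_; proj₁; proj₂)
open import Data.Sum using (_⊎_; inj₁; inj₂)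
open import Relation.Binary.PropositionalEquality
open import Relation.Nullary using (¬_; does; yes; no)
open import Relation.Binary.Definitions using (DecidableEquality)
open import Function using (_∘_)
open import Data.Nat.Tactic.RingSolver using (solve-∀)
open ≡-Reasoning

even : ℕ → Bool
even zero = true
even (suc zero) = false
even (suc (suc x)) = even x

even-suc : ∀ x → even (suc x) ≡ not (even x)
even-suc zero = refl
even-suc (suc zero) = refl
even-suc (suc (suc x)) = even-suc x

even-double : ∀ m → even (m + m) ≡ true
even-double zero = refl
even-double (suc m) rewrite +-suc m m = even-double m

⌊suc/2⌋-even : ∀ x → even x ≡ true → ⌊ suc x /2⌋ ≡ ⌊ x /2⌋
⌊suc/2⌋-even zero _ = refl
⌊suc/2⌋-even (suc (suc x)) e = cong suc (⌊suc/2⌋-even x e)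

prepend : Bool → (ℕ → Bool) → ℕ → Bool
prepend b f zero = b
prepend b f (suc i) = f i

labellings : ℕ → List (ℕ → Bool)
labellings zero = (λ _ → false) ∷ []
labellings (suc m) = map (prepend true) (labellings m) ++ map (prepend false) (labellings m)

DifferBelow : ℕ → (ℕ → Bool) → (ℕ → Bool) → Set
DifferBelow m f g = ∃ λ i → i < m × f i ≢ g i

labellings-differ : ∀ m → AllPairs (DifferBelow m) (labellings m)
labellings-differ zero = [] ∷ []
labellings-differ (suc m) =
  AllPairsₚ.++⁺ (shifted true) (shifted false)
    (Allₚ.map⁺ (All.universal (λ _ → Allₚ.map⁺ (All.universal (λ _ → 0 , s≤s z≤n , λ ()) _)) _))
  where
  shifted : ∀ b → AllPairs (DifferBelow (suc m)) (map (prepend b) (labellings m))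
  shifted b = AllPairsₚ.map⁺ (AllPairs.map (λ (i , i<m , f≢g) → suc i , s≤s i<m , f≢g) (labellings-differ m))

length-labellings : ∀ m → length (labellings m) ≡ 2 ^ m
length-labellings zero = refl
length-labellings (suc m) = begin
  length (map (prepend true) (labellings m) ++ map (prepend false) (labellings m))
    ≡⟨ length-++ (map (prepend true) (labellings m)) ⟩
  length (map (prepend true) (labellings m)) + length (map (prepend false) (labellings m))
    ≡⟨ cong₂ _+_ (length-map (prepend true) (labellings m)) (length-map (prepend false) (labellings m)) ⟩
  length (labellings m) + length (labellings m)
    ≡⟨ cong₂ _+_ (length-labellings m) (trans (length-labellings m) (sym (+-identityʳ _))) ⟩
  2 ^ m + (2 ^ m + 0) ∎

map-≢⇒pointwise-≢ : ∀ {A B : Set} → DecidableEquality B → (f g : A → B) (xs : List A) →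
  map f xs ≢ map g xs → ∃ λ x → f x ≢ g x
map-≢⇒pointwise-≢ _≟_ f g [] ne = ⊥-elim (ne refl)
map-≢⇒pointwise-≢ _≟_ f g (x ∷ xs) ne with f x ≟ g x
... | no fx≢gx = x , fx≢gx
... | yes fx≡gx = map-≢⇒pointwise-≢ _≟_ f g xs (ne ∘ cong₂ _∷_ fx≡gx)

module Modular {k : ℕ} .{{_ : NonZero k}} where

  infix 4 _≋_
  _≋_ : ℕ → ℕ → Set
  x ≋ y = x % k ≡ y % k

  ≋-refl : ∀ x → x ≋ x
  ≋-refl x = refl

  %-≋ : ∀ x → x % k ≋ x
  %-≋ x = m%n%n≡m%n x k

  +-self-≋ : ∀ x → x + k ≋ x
  +-self-≋ x = [m+n]%n≡m%n x k

  +-≋ : ∀ {x x′ y y′} → x ≋ x′ → y ≋ y′ → x + y ≋ x′ + y′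
  +-≋ {x} {x′} {y} {y′} p q = begin
    (x + y) % k               ≡⟨ %-distribˡ-+ x y k ⟩
    (x % k + y % k) % k       ≡⟨ cong₂ (λ a b → (a + b) % k) p q ⟩
    (x′ % k + y′ % k) % k     ≡⟨ %-distribˡ-+ x′ y′ k ⟨
    (x′ + y′) % k             ∎

  *-≋ : ∀ {x x′} y → x ≋ x′ → x * y ≋ x′ * y
  *-≋ {x} {x′} y p = begin
    (x * y) % k               ≡⟨ %-distribˡ-* x y k ⟩
    (x % k * (y % k)) % k     ≡⟨ cong (λ a → (a * (y % k)) % k) p ⟩
    (x′ % k * (y % k)) % k    ≡⟨ %-distribˡ-* x′ y k ⟨
    (x′ * y) % k              ∎

  suc-≋ : ∀ x → suc (x % k) ≋ suc x
  suc-≋ x = +-≋ (≋-refl 1) (%-≋ x)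

  toℕ-mod-≋ : ∀ x → toℕ (x mod k) ≋ x
  toℕ-mod-≋ x = trans (cong (_% k) (toℕ-fromℕ< _)) (%-≋ x)

  toℕ-mod-small : ∀ {x} → x < k → toℕ (x mod k) ≡ x
  toℕ-mod-small x<k = trans (toℕ-fromℕ< _) (m<n⇒m%n≡m x<k)

  mod-≋-toℕ : ∀ {x} (i : Fin k) → x ≋ toℕ i → x mod k ≡ i
  mod-≋-toℕ i p = trans (fromℕ<-cong _ _ (trans p (m<n⇒m%n≡m (toℕ<n i))) _ (toℕ<n i)) (fromℕ<-toℕ i (toℕ<n i))

  sucMod predMod : Fin k → Fin k
  sucMod i = suc (toℕ i) mod k
  predMod i = (toℕ i + pred k) mod k

  private
    suc-+-pred : ∀ x → suc (x + pred k) ≡ x + k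
    suc-+-pred x = trans (sym (+-suc x (pred k))) (cong (x +_) (suc-pred k))

  sucMod-predMod : ∀ i → sucMod (predMod i) ≡ i
  sucMod-predMod i = mod-≋-toℕ i (begin
    suc (toℕ (predMod i)) % k       ≡⟨ +-≋ (≋-refl 1) (toℕ-mod-≋ (toℕ i + pred k)) ⟩
    suc (toℕ i + pred k) % k        ≡⟨ cong (_% k) (suc-+-pred (toℕ i)) ⟩
    (toℕ i + k) % k                 ≡⟨ +-self-≋ (toℕ i) ⟩
    toℕ i % k                       ∎)

  predMod-sucMod : ∀ i → predMod (sucMod i) ≡ i
  predMod-sucMod i = mod-≋-toℕ i (begin
    (toℕ (sucMod i) + pred k) % k   ≡⟨ +-≋ (toℕ-mod-≋ (suc (toℕ i))) (≋-refl (pred k)) ⟩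
    (suc (toℕ i) + pred k) % k      ≡⟨ cong (_% k) (suc-+-pred (toℕ i)) ⟩
    (toℕ i + k) % k                 ≡⟨ +-self-≋ (toℕ i) ⟩
    toℕ i % k                       ∎)

  +-self-mod : ∀ (i : Fin k) → (toℕ i + k) mod k ≡ i
  +-self-mod i = mod-≋-toℕ i (+-self-≋ (toℕ i))

module FlipGraph (N M R : ℕ) .{{_ : NonZero N}} .{{_ : NonZero M}} where
  open Torus N M R

  ParallelPairOnFace : EdgeSet → Face → Set
  ParallelPairOnFace m f =
    (m (false , f) ≡ true × m (false , vertNext f) ≡ true) ⊎
    (m (true , f) ≡ true × m (true , horNext f) ≡ true)

  horizontal-vertical-exclusive : ∀ {m v u w} → IsPerfectMatching m →
    Incident v (false , u) → Incident v (true , w) → m (false , u) ≡ true → m (true , w) ≡ true → ⊥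
  horizontal-vertical-exclusive {v = v} pm i i′ p p′ with proj₂ (pm v) _ _ p i p′ i′
  ... | ()

  flip-has-parallel-pair : ∀ {m m′ f} → IsPerfectMatching m → IsPerfectMatching m′ →
    SymDiffIsBoundary m m′ f → ParallelPairOnFace m f
  flip-has-parallel-pair {m} {m′} {f} pm pm′ sd = by-cases (m (false , f)) refl (m (true , f)) refl
    where
    flipped : ∀ {e} → InBoundary f e → m e ≡ false → m′ e ≡ true
    flipped b p = trans (¬-not (λ q → proj₂ (sd _) b (sym q))) (cong not p)

    by-cases : ∀ a → m (false , f) ≡ a → ∀ b → m (true , f) ≡ b → ParallelPairOnFace m f
    by-cases true h true v = ⊥-elim (horizontal-vertical-exclusive pm (inj₁ refl) (inj₁ refl) h v)
    by-cases false h false v = ⊥-elim (horizontal-vertical-exclusive pm′ (inj₁ refl) (inj₁ refl)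
      (flipped (inj₁ refl) h) (flipped (inj₂ (inj₂ (inj₁ refl))) v))
    by-cases true h false v = upper (m (false , vertNext f)) refl
      where
      upper : ∀ a → m (false , vertNext f) ≡ a → ParallelPairOnFace m f
      upper true h′ = inj₁ (h , h′)
      upper false h′ = ⊥-elim (horizontal-vertical-exclusive pm′ (inj₁ refl) (inj₂ refl)
        (flipped (inj₂ (inj₁ refl)) h′) (flipped (inj₂ (inj₂ (inj₁ refl))) v))
    by-cases false h true v = right (m (true , horNext f)) refl
      where
      right : ∀ a → m (true , horNext f) ≡ a → ParallelPairOnFace m f
      right true v′ = inj₂ (v , v′)
      right false v′ = ⊥-elim (horizontal-vertical-exclusive pm′ (inj₂ refl) (inj₁ refl)
        (flipped (inj₁ refl) h) (flipped (inj₂ (inj₂ (inj₂ refl))) v′))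

  distinct-on : ∀ (m m′ : PerfectMatching) es → map (proj₁ m) es ≢ map (proj₁ m′) es → Distinct m m′
  distinct-on (m , _) (m′ , _) = map-≢⇒pointwise-≢ _≟ᵇ_ m m′

  isolated-without-parallel-pairs : (m : PerfectMatching) →
    (∀ f → ¬ ParallelPairOnFace (proj₁ m) f) → IsolatedInFlipGraph m
  isolated-without-parallel-pairs (m , pm) none (m′ , pm′) (f , sd) =
    none f (flip-has-parallel-pair pm pm′ sd)

module RectangularTorus (N M : ℕ) .{{_ : NonZero N}} .{{_ : NonZero M}} where
  open Torus N M M
  open FlipGraph N M M
  private
    module Row = Modular {N}
    module Col = Modular {M}

  horPrev vertPrev : Vertex → Vertex
  horPrev (i , j) = i , Col.predMod j
  vertPrev (i , j) = Row.predMod i , j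

  vertNext-≡ : ∀ i j → vertNext (i , j) ≡ (Row.sucMod i , j)
  vertNext-≡ i j = cong (Row.sucMod i ,_) (column-kept (does (suc (toℕ i) <? N)))
    where
    column-kept : ∀ b → (if b then j else colMod (toℕ j + M)) ≡ j
    column-kept true = refl
    column-kept false = Col.+-self-mod j

  horNext-horPrev : ∀ v → horNext (horPrev v) ≡ v
  horNext-horPrev (i , j) = cong (i ,_) (Col.sucMod-predMod j)

  horPrev-horNext : ∀ u → horPrev (horNext u) ≡ u
  horPrev-horNext (i , j) = cong (i ,_) (Col.predMod-sucMod j)

  vertNext-vertPrev : ∀ v → vertNext (vertPrev v) ≡ v
  vertNext-vertPrev (i , j) = trans (vertNext-≡ (Row.predMod i) j) (cong (_, j) (Row.sucMod-predMod i))

  vertPrev-vertNext : ∀ u → vertPrev (vertNext u) ≡ u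
  vertPrev-vertNext (i , j) = trans (cong vertPrev (vertNext-≡ i j)) (cong (_, j) (Row.predMod-sucMod i))

  record Checkerboard (c : Vertex → Bool) : Set where
    field
      flips-horizontally : ∀ u → c (horNext u) ≡ not (c u)
      flips-vertically   : ∀ u → c (vertNext u) ≡ not (c u)

    flips-horPrev : ∀ v → c (horPrev v) ≡ not (c v)
    flips-horPrev v = begin
      c (horPrev v)                      ≡⟨ not-involutive _ ⟨
      not (not (c (horPrev v)))          ≡⟨ cong not (flips-horizontally (horPrev v)) ⟨
      not (c (horNext (horPrev v)))      ≡⟨ cong (not ∘ c) (horNext-horPrev v) ⟩
      not (c v)                          ∎

    flips-vertPrev : ∀ v → c (vertPrev v) ≡ not (c v)
    flips-vertPrev v = begin
      c (vertPrev v)                     ≡⟨ not-involutive _ ⟨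
      not (not (c (vertPrev v)))         ≡⟨ cong not (flips-vertically (vertPrev v)) ⟨
      not (c (vertNext (vertPrev v)))    ≡⟨ cong (not ∘ c) (vertNext-vertPrev v) ⟩
      not (c v)                          ∎

  checkerboard-not : ∀ {c} → Checkerboard c → Checkerboard (not ∘ c)
  checkerboard-not cb = record
    { flips-horizontally = λ u → cong not (flips-horizontally u)
    ; flips-vertically   = λ u → cong not (flips-vertically u)
    }
    where open Checkerboard cb

  -- Vertex v lies on a horizontal domino iff lb v; that domino joins v to horNext v
  -- if hd v and to horPrev v otherwise (vertical dominoes likewise, according to vd).
  module Staircase (hd vd lb : Vertex → Bool) (hd-cb : Checkerboard hd) (vd-cb : Checkerboard vd)
                   (lb-horNext : ∀ u → hd u ≡ true → lb (horNext u) ≡ lb u)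
                   (lb-vertNext : ∀ u → vd u ≡ true → lb (vertNext u) ≡ lb u) where
    private
      module H = Checkerboard hd-cb
      module V = Checkerboard vd-cb

    dominoes : EdgeSet
    dominoes (false , u) = hd u ∧ lb u
    dominoes (true , u) = vd u ∧ not (lb u)

    horizontalCover verticalCover : Bool → Vertex → Edge
    horizontalCover true v = false , v
    horizontalCover false v = false , horPrev v
    verticalCover true v = true , v
    verticalCover false v = true , vertPrev v

    cover : Vertex → Edge
    cover v = if lb v then horizontalCover (hd v) v else verticalCover (vd v) v

    cover-horizontal : ∀ {v h} → lb v ≡ true → hd v ≡ h → cover v ≡ horizontalCover h v
    cover-horizontal l refl rewrite l = refl

    cover-vertical : ∀ {v w} → lb v ≡ false → vd v ≡ w → cover v ≡ verticalCover w v
    cover-vertical l refl rewrite l = refl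

    lb-horPrev : ∀ v → hd v ≡ false → lb (horPrev v) ≡ lb v
    lb-horPrev v h = trans (sym (lb-horNext (horPrev v) (trans (H.flips-horPrev v) (cong not h))))
                           (cong lb (horNext-horPrev v))

    lb-vertPrev : ∀ v → vd v ≡ false → lb (vertPrev v) ≡ lb v
    lb-vertPrev v w = trans (sym (lb-vertNext (vertPrev v) (trans (V.flips-vertPrev v) (cong not w))))
                            (cong lb (vertNext-vertPrev v))

    cover-chosen : ∀ v → dominoes (cover v) ≡ true × Incident v (cover v)
    cover-chosen v with lb v in l | hd v in h | vd v in w
    ... | true | true | _ = cong₂ _∧_ h l , inj₁ refl
    ... | true | false | _ =
      cong₂ _∧_ (trans (H.flips-horPrev v) (cong not h)) (trans (lb-horPrev v h) l) ,
      inj₂ (sym (horNext-horPrev v))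
    ... | false | _ | true = cong₂ _∧_ w (cong not l) , inj₁ refl
    ... | false | _ | false =
      cong₂ _∧_ (trans (V.flips-vertPrev v) (cong not w)) (cong not (trans (lb-vertPrev v w) l)) ,
      inj₂ (sym (vertNext-vertPrev v))

    cover-unique : ∀ v e → dominoes e ≡ true → Incident v e → e ≡ cover v
    cover-unique v (false , u) p (inj₁ refl) =
      sym (cover-horizontal (∧-conicalʳ _ _ p) (∧-conicalˡ _ _ p))
    cover-unique v (false , u) p (inj₂ refl) = sym (begin
      cover (horNext u)                  ≡⟨ cover-horizontal (trans (lb-horNext u h) (∧-conicalʳ _ _ p))
                                                             (trans (H.flips-horizontally u) (cong not h)) ⟩
      (false , horPrev (horNext u))      ≡⟨ cong (false ,_) (horPrev-horNext u) ⟩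
      (false , u)                        ∎)
      where h = ∧-conicalˡ _ _ p
    cover-unique v (true , u) p (inj₁ refl) =
      sym (cover-vertical (not-injective (∧-conicalʳ _ _ p)) (∧-conicalˡ _ _ p))
    cover-unique v (true , u) p (inj₂ refl) = sym (begin
      cover (vertNext u)                 ≡⟨ cover-vertical (trans (lb-vertNext u w) (not-injective (∧-conicalʳ _ _ p)))
                                                           (trans (V.flips-vertically u) (cong not w)) ⟩
      (true , vertPrev (vertNext u))     ≡⟨ cong (true ,_) (vertPrev-vertNext u) ⟩
      (true , u)                         ∎)
      where w = ∧-conicalˡ _ _ p

    matching : PerfectMatching
    matching = dominoes , λ v →
      (cover v , cover-chosen v) ,
      λ e e′ p i p′ i′ → trans (cover-unique v e p i) (sym (cover-unique v e′ p′ i′))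

    no-parallel-pairs : ∀ f → ¬ ParallelPairOnFace dominoes f
    no-parallel-pairs f (inj₁ (p , q))
      with trans (sym (∧-conicalˡ _ _ q)) (trans (H.flips-vertically f) (cong not (∧-conicalˡ _ _ p)))
    ... | ()
    no-parallel-pairs f (inj₂ (p , q))
      with trans (sym (∧-conicalˡ _ _ q)) (trans (V.flips-horizontally f) (cong not (∧-conicalˡ _ _ p)))
    ... | ()

    isolated : IsolatedInFlipGraph matching
    isolated = isolated-without-parallel-pairs matching no-parallel-pairs

module EvenSquareTorus (n : ℕ) .{{_ : NonZero (2 * n)}} (2≤n : 2 ≤ n) where
  N : ℕ
  N = 2 * n

  open Torus N N N
  open FlipGraph N N N
  open RectangularTorus N N
  open Modular {N}

  even-N : even N ≡ true
  even-N = trans (cong (λ m → even (n + m)) (+-identityʳ n)) (even-double n)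

  even-suc-mod : ∀ {x} → x < N → even (suc x % N) ≡ not (even x)
  even-suc-mod {x} x<N with m≤n⇒m<n∨m≡n x<N
  ... | inj₁ sx<N = trans (cong even (m<n⇒m%n≡m sx<N)) (even-suc x)
  ... | inj₂ sx≡N = begin
    even (suc x % N)      ≡⟨ cong (λ y → even (y % N)) sx≡N ⟩
    even (N % N)          ≡⟨ cong even (n%n≡0 N) ⟩
    true                  ≡⟨ even-N ⟨
    even N                ≡⟨ cong even sx≡N ⟨
    even (suc x)          ≡⟨ even-suc x ⟩
    not (even x)          ∎

  half-suc-mod : ∀ {x} → x < N → even x ≡ true → ⌊ suc x % N /2⌋ ≡ ⌊ x /2⌋
  half-suc-mod {x} x<N e with m≤n⇒m<n∨m≡n x<N
  ... | inj₁ sx<N = trans (cong ⌊_/2⌋ (m<n⇒m%n≡m sx<N)) (⌊suc/2⌋-even x e)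
  ... | inj₂ sx≡N with trans (sym even-N) (trans (cong even (sym sx≡N)) (trans (even-suc x) (cong not e)))
  ...   | ()

  antidiagonal diagonal : ℕ → Vertex → ℕ
  antidiagonal o (i , j) = (toℕ i + toℕ j + o) % N
  -- pred N plays the role of -1 modulo N.
  diagonal o (i , j) = (toℕ j + toℕ i * pred N + o) % N

  antidiagonal<N : ∀ o u → antidiagonal o u < N
  antidiagonal<N o (i , j) = m%n<n _ N

  diagonal<N : ∀ o u → diagonal o u < N
  diagonal<N o (i , j) = m%n<n _ N

  antidiagonal-horNext : ∀ o u → antidiagonal o (horNext u) ≡ suc (antidiagonal o u) % N
  antidiagonal-horNext o (i , j) = begin
    (toℕ i + toℕ (sucMod j) + o) % N      ≡⟨ +-≋ (+-≋ (≋-refl (toℕ i)) (toℕ-mod-≋ (suc (toℕ j)))) (≋-refl o) ⟩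
    (toℕ i + suc (toℕ j) + o) % N         ≡⟨ cong (λ x → (x + o) % N) (+-suc (toℕ i) (toℕ j)) ⟩
    suc (toℕ i + toℕ j + o) % N           ≡⟨ suc-≋ _ ⟨
    suc (antidiagonal o (i , j)) % N      ∎

  antidiagonal-vertNext : ∀ o u → antidiagonal o (vertNext u) ≡ suc (antidiagonal o u) % N
  antidiagonal-vertNext o (i , j) = begin
    antidiagonal o (vertNext (i , j))     ≡⟨ cong (antidiagonal o) (vertNext-≡ i j) ⟩
    (toℕ (sucMod i) + toℕ j + o) % N      ≡⟨ +-≋ (+-≋ (toℕ-mod-≋ (suc (toℕ i))) (≋-refl (toℕ j))) (≋-refl o) ⟩
    suc (toℕ i + toℕ j + o) % N           ≡⟨ suc-≋ _ ⟨
    suc (antidiagonal o (i , j)) % N      ∎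

  diagonal-horNext : ∀ o u → diagonal o (horNext u) ≡ suc (diagonal o u) % N
  diagonal-horNext o (i , j) = begin
    (toℕ (sucMod j) + toℕ i * pred N + o) % N  ≡⟨ +-≋ (+-≋ (toℕ-mod-≋ (suc (toℕ j))) (≋-refl (toℕ i * pred N))) (≋-refl o) ⟩
    suc (toℕ j + toℕ i * pred N + o) % N       ≡⟨ suc-≋ _ ⟨
    suc (diagonal o (i , j)) % N               ∎

  diagonal-vertNext : ∀ o u → diagonal o u ≡ suc (diagonal o (vertNext u)) % N
  diagonal-vertNext o (i , j) = sym (begin
    suc (diagonal o (vertNext (i , j))) % N               ≡⟨ cong (λ v → suc (diagonal o v) % N) (vertNext-≡ i j) ⟩
    suc ((toℕ j + toℕ (sucMod i) * pred N + o) % N) % N  ≡⟨ suc-≋ _ ⟩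
    suc (toℕ j + toℕ (sucMod i) * pred N + o) % N        ≡⟨ +-≋ (≋-refl 1) (+-≋ (+-≋ (≋-refl (toℕ j))
                                                              (*-≋ (pred N) (toℕ-mod-≋ (suc (toℕ i))))) (≋-refl o)) ⟩
    suc (toℕ j + suc (toℕ i) * pred N + o) % N          ≡⟨ cong (_% N) (rearrange (toℕ j) (toℕ i) (pred N) o) ⟩
    (toℕ j + toℕ i * pred N + o + suc (pred N)) % N     ≡⟨ cong (λ m → (toℕ j + toℕ i * pred N + o + m) % N) (suc-pred N) ⟩
    (toℕ j + toℕ i * pred N + o + N) % N                ≡⟨ +-self-≋ _ ⟩
    diagonal o (i , j)                                   ∎)
    where
    rearrange : ∀ a b c d → suc (a + suc b * c + d) ≡ a + b * c + d + suc c
    rearrange = solve-∀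

  ⌊antidiagonal/2⌋-horNext : ∀ o u → even (antidiagonal o u) ≡ true →
    ⌊ antidiagonal o (horNext u) /2⌋ ≡ ⌊ antidiagonal o u /2⌋
  ⌊antidiagonal/2⌋-horNext o u e =
    trans (cong ⌊_/2⌋ (antidiagonal-horNext o u)) (half-suc-mod (antidiagonal<N o u) e)

  ⌊antidiagonal/2⌋-vertNext : ∀ o u → even (antidiagonal o u) ≡ true →
    ⌊ antidiagonal o (vertNext u) /2⌋ ≡ ⌊ antidiagonal o u /2⌋
  ⌊antidiagonal/2⌋-vertNext o u e =
    trans (cong ⌊_/2⌋ (antidiagonal-vertNext o u)) (half-suc-mod (antidiagonal<N o u) e)

  antidiagonal-checkerboard : ∀ o → Checkerboard (even ∘ antidiagonal o)
  antidiagonal-checkerboard o = record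
    { flips-horizontally = λ u → trans (cong even (antidiagonal-horNext o u)) (even-suc-mod (antidiagonal<N o u))
    ; flips-vertically   = λ u → trans (cong even (antidiagonal-vertNext o u)) (even-suc-mod (antidiagonal<N o u))
    }

  module Antidiagonal (o : ℕ) (L : ℕ → Bool) = Staircase
    (even ∘ antidiagonal o) (even ∘ antidiagonal o) (L ∘ ⌊_/2⌋ ∘ antidiagonal o)
    (antidiagonal-checkerboard o) (antidiagonal-checkerboard o)
    (λ u e → cong L (⌊antidiagonal/2⌋-horNext o u e))
    (λ u e → cong L (⌊antidiagonal/2⌋-vertNext o u e))

  even-diagonal-vertNext : ∀ o u → even (diagonal o (vertNext u)) ≡ not (even (diagonal o u))
  even-diagonal-vertNext o u = begin
    even (diagonal o (vertNext u))                        ≡⟨ not-involutive _ ⟨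
    not (not (even (diagonal o (vertNext u))))            ≡⟨ cong not (even-suc-mod (diagonal<N o (vertNext u))) ⟨
    not (even (suc (diagonal o (vertNext u)) % N))        ≡⟨ cong (not ∘ even) (diagonal-vertNext o u) ⟨
    not (even (diagonal o u))                             ∎

  ⌊diagonal/2⌋-horNext : ∀ o u → even (diagonal o u) ≡ true →
    ⌊ diagonal o (horNext u) /2⌋ ≡ ⌊ diagonal o u /2⌋
  ⌊diagonal/2⌋-horNext o u e =
    trans (cong ⌊_/2⌋ (diagonal-horNext o u)) (half-suc-mod (diagonal<N o u) e)

  ⌊diagonal/2⌋-vertNext : ∀ o u → not (even (diagonal o u)) ≡ true →
    ⌊ diagonal o (vertNext u) /2⌋ ≡ ⌊ diagonal o u /2⌋
  ⌊diagonal/2⌋-vertNext o u odd = sym (trans (cong ⌊_/2⌋ (diagonal-vertNext o u))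
    (half-suc-mod (diagonal<N o (vertNext u)) (trans (even-diagonal-vertNext o u) odd)))

  diagonal-checkerboard : ∀ o → Checkerboard (even ∘ diagonal o)
  diagonal-checkerboard o = record
    { flips-horizontally = λ u → trans (cong even (diagonal-horNext o u)) (even-suc-mod (diagonal<N o u))
    ; flips-vertically   = even-diagonal-vertNext o
    }

  module Diagonal (o : ℕ) (L : ℕ → Bool) = Staircase
    (even ∘ diagonal o) (not ∘ even ∘ diagonal o) (L ∘ ⌊_/2⌋ ∘ diagonal o)
    (diagonal-checkerboard o) (checkerboard-not (diagonal-checkerboard o))
    (λ u e → cong L (⌊diagonal/2⌋-horNext o u e))
    (λ u odd → cong L (⌊diagonal/2⌋-vertNext o u odd))

  2<N : 2 < N
  2<N = ≤-trans (s≤s (s≤s (s≤s z≤n))) (+-mono-≤ 2≤n (≤-trans 2≤n (m≤m+n n 0)))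

  1<N : 1 < N
  1<N = <-trans (s≤s (s≤s z≤n)) 2<N

  0<N : 0 < N
  0<N = <-trans (s≤s z≤n) 1<N

  pred[N]<N : pred N < N
  pred[N]<N = m≤pred[n]⇒suc[m]≤n ≤-refl

  even-pred-N : even (pred N) ≡ false
  even-pred-N = begin
    even (pred N)               ≡⟨ not-involutive _ ⟨
    not (not (even (pred N)))   ≡⟨ cong not (even-suc (pred N)) ⟨
    not (even (suc (pred N)))   ≡⟨ cong (not ∘ even) (suc-pred N) ⟩
    not (even N)                ≡⟨ cong not even-N ⟩
    false                       ∎

  antidiagonal-at : ∀ o {p q} → p < N → q < N → antidiagonal o (p mod N , q mod N) ≡ (p + q + o) % N
  antidiagonal-at o p<N q<N = cong₂ (λ a b → (a + b + o) % N) (toℕ-mod-small p<N) (toℕ-mod-small q<N)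

  diagonal-at : ∀ o {p q} → p < N → q < N → diagonal o (p mod N , q mod N) ≡ (q + p * pred N + o) % N
  diagonal-at o p<N q<N = cong₂ (λ a b → (b + a * pred N + o) % N) (toℕ-mod-small p<N) (toℕ-mod-small q<N)

  antidiagonal-labels-differ : ∀ o {L L′} → o ≤ N → DifferBelow n L L′ →
    Distinct (Antidiagonal.matching o L) (Antidiagonal.matching o L′)
  antidiagonal-labels-differ o {L} {L′} o≤N (i , i<n , Li≢L′i) =
    (false , w) , λ eq → Li≢L′i (trans (sym (horizontal-at L)) (trans eq (horizontal-at L′)))
    where
    w : Vertex
    w = (N ∸ o) mod N , (i + i) mod N

    i+i<N : i + i < N
    i+i<N = subst (i + i <_) (cong (n +_) (sym (+-identityʳ n))) (+-mono-< i<n i<n)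

    at-w : antidiagonal o w ≡ i + i
    at-w = begin
      antidiagonal o w                ≡⟨ +-≋ (+-≋ (toℕ-mod-≋ (N ∸ o)) (toℕ-mod-≋ (i + i))) (≋-refl o) ⟩
      (N ∸ o + (i + i) + o) % N       ≡⟨ cong (_% N) (regroup (N ∸ o) (i + i) o) ⟩
      (i + i + (o + (N ∸ o))) % N     ≡⟨ cong (λ m → (i + i + m) % N) (m+[n∸m]≡n o≤N) ⟩
      (i + i + N) % N                 ≡⟨ +-self-≋ (i + i) ⟩
      (i + i) % N                     ≡⟨ m<n⇒m%n≡m i+i<N ⟩
      i + i                           ∎
      where
      regroup : ∀ a b c → a + b + c ≡ b + (c + a)
      regroup = solve-∀

    horizontal-at : ∀ L → even (antidiagonal o w) ∧ L ⌊ antidiagonal o w /2⌋ ≡ L i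
    horizontal-at L = begin
      even (antidiagonal o w) ∧ L ⌊ antidiagonal o w /2⌋   ≡⟨ cong (λ s → even s ∧ L ⌊ s /2⌋) at-w ⟩
      even (i + i) ∧ L ⌊ i + i /2⌋                         ≡⟨ cong₂ _∧_ (even-double i) (cong L (sym (n≡⌊n+n/2⌋ i))) ⟩
      L i                                                  ∎

  origin : Vertex
  origin = 0 mod N , 0 mod N

  antidiagonal-origin : ∀ o → o < N → antidiagonal o origin ≡ o
  antidiagonal-origin o o<N = trans (antidiagonal-at o 0<N 0<N) (m<n⇒m%n≡m o<N)

  antidiagonal-offsets-differ : ∀ L L′ →
    Distinct (Antidiagonal.matching 0 L) (Antidiagonal.matching (pred N) L′)
  antidiagonal-offsets-differ L L′ =
    distinct-on (Antidiagonal.matching 0 L) (Antidiagonal.matching (pred N) L′) ((false , origin) ∷ (true , origin) ∷ [])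
      (λ eq → differ (L 0) (trans (sym at-origin-0) (trans eq at-origin-pred)))
    where
    at-origin-0 : map (Antidiagonal.dominoes 0 L) ((false , origin) ∷ (true , origin) ∷ []) ≡ L 0 ∷ not (L 0) ∷ []
    at-origin-0 = cong (λ s → even s ∧ L ⌊ s /2⌋ ∷ even s ∧ not (L ⌊ s /2⌋) ∷ []) (antidiagonal-origin 0 0<N)

    at-origin-pred : map (Antidiagonal.dominoes (pred N) L′) ((false , origin) ∷ (true , origin) ∷ []) ≡ false ∷ false ∷ []
    at-origin-pred = trans
      (cong (λ s → even s ∧ L′ ⌊ s /2⌋ ∷ even s ∧ not (L′ ⌊ s /2⌋) ∷ []) (antidiagonal-origin (pred N) pred[N]<N))
      (cong (λ e → e ∧ L′ ⌊ pred N /2⌋ ∷ e ∧ not (L′ ⌊ pred N /2⌋) ∷ []) even-pred-N)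

    differ : ∀ b → b ∷ not b ∷ [] ≢ false ∷ false ∷ []
    differ true ()
    differ false ()

  va vb : Vertex
  va = 0 mod N , 2 mod N
  vb = 1 mod N , 1 mod N

  sample : PerfectMatching → List Bool
  sample (m , _) = map m ((false , va) ∷ (false , vb) ∷ (true , va) ∷ (true , vb) ∷ [])

  samples-differ : ∀ m m′ {s s′} → sample m ≡ s → sample m′ ≡ s′ → s ≢ s′ → Distinct m m′
  samples-differ m m′ p p′ s≢s′ = distinct-on m m′ _ (λ eq → s≢s′ (trans (sym p) (trans eq p′)))

  -- va and vb lie on the same antidiagonal, so every antidiagonal tiling treats them alike.
  antidiagonal-sample : ∀ o L → ∃ λ x → ∃ λ y → sample (Antidiagonal.matching o L) ≡ x ∷ x ∷ y ∷ y ∷ []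
  antidiagonal-sample o L = _ , _ , cong
    (λ s → even s ∧ L ⌊ s /2⌋ ∷ even σ ∧ L ⌊ σ /2⌋ ∷ even s ∧ not (L ⌊ s /2⌋) ∷ even σ ∧ not (L ⌊ σ /2⌋) ∷ [])
    (trans (antidiagonal-at o 0<N 2<N) (sym (antidiagonal-at o 1<N 1<N)))
    where σ = antidiagonal o vb

  Unbalanced : List Bool → Set
  Unbalanced s = ∀ x y → x ∷ x ∷ y ∷ y ∷ [] ≢ s

  diagonal-sample : ∀ o L {a b} → diagonal o va ≡ a → diagonal o vb ≡ b →
    sample (Diagonal.matching o L) ≡
      even a ∧ L ⌊ a /2⌋ ∷ even b ∧ L ⌊ b /2⌋ ∷ not (even a) ∧ not (L ⌊ a /2⌋) ∷ not (even b) ∧ not (L ⌊ b /2⌋) ∷ []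
  diagonal-sample o L = cong₂ (λ a b →
    even a ∧ L ⌊ a /2⌋ ∷ even b ∧ L ⌊ b /2⌋ ∷ not (even a) ∧ not (L ⌊ a /2⌋) ∷ not (even b) ∧ not (L ⌊ b /2⌋) ∷ [])

  diagonal-0-va : diagonal 0 va ≡ 2
  diagonal-0-va = trans (diagonal-at 0 0<N 2<N) (m<n⇒m%n≡m 2<N)

  diagonal-0-vb : diagonal 0 vb ≡ 0
  diagonal-0-vb = begin
    diagonal 0 vb                  ≡⟨ diagonal-at 0 1<N 1<N ⟩
    (1 + (pred N + 0) + 0) % N     ≡⟨ cong (λ m → suc m % N) (trans (+-identityʳ _) (+-identityʳ _)) ⟩
    suc (pred N) % N               ≡⟨ cong (_% N) (suc-pred N) ⟩
    N % N                          ≡⟨ n%n≡0 N ⟩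
    0                              ∎

  diagonal-pred-va : diagonal (pred N) va ≡ 1
  diagonal-pred-va = begin
    diagonal (pred N) va           ≡⟨ diagonal-at (pred N) 0<N 2<N ⟩
    suc (suc (pred N)) % N         ≡⟨ cong (λ m → suc m % N) (suc-pred N) ⟩
    (1 + N) % N                    ≡⟨ +-self-≋ 1 ⟩
    1 % N                          ≡⟨ m<n⇒m%n≡m 1<N ⟩
    1                              ∎

  diagonal-pred-vb : diagonal (pred N) vb ≡ pred N
  diagonal-pred-vb = begin
    diagonal (pred N) vb           ≡⟨ diagonal-at (pred N) 1<N 1<N ⟩
    (1 + (pred N + 0) + pred N) % N ≡⟨ cong (λ m → suc (m + pred N) % N) (+-identityʳ (pred N)) ⟩
    suc (pred N + pred N) % N      ≡⟨ cong (_% N) (trans (sym (+-suc (pred N) (pred N))) (cong (pred N +_) (suc-pred N))) ⟩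
    (pred N + N) % N               ≡⟨ +-self-≋ (pred N) ⟩
    pred N % N                     ≡⟨ m<n⇒m%n≡m pred[N]<N ⟩
    pred N                         ∎

  ⌊pred[N]/2⌋≢0 : (⌊ pred N /2⌋ ≡ᵇ 0) ≡ false
  ⌊pred[N]/2⌋≢0 = positive (⌊n/2⌋-mono (<⇒≤pred 2<N))
    where
    positive : ∀ {x} → 1 ≤ x → (x ≡ᵇ 0) ≡ false
    positive (s≤s _) = refl

  isZero : ℕ → Bool
  isZero = _≡ᵇ 0

  -- With a constant label a diagonal tiling coincides with an antidiagonal one.
  X₁ X₂ X₃ X₄ : PerfectMatching
  X₁ = Diagonal.matching 0 isZero
  X₂ = Diagonal.matching 0 (not ∘ isZero)
  X₃ = Diagonal.matching (pred N) isZero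
  X₄ = Diagonal.matching (pred N) (not ∘ isZero)

  extras : List PerfectMatching
  extras = X₁ ∷ X₂ ∷ X₃ ∷ X₄ ∷ []

  sample-X₁ : sample X₁ ≡ false ∷ true ∷ false ∷ false ∷ []
  sample-X₁ = diagonal-sample 0 isZero diagonal-0-va diagonal-0-vb

  sample-X₂ : sample X₂ ≡ true ∷ false ∷ false ∷ false ∷ []
  sample-X₂ = diagonal-sample 0 (not ∘ isZero) diagonal-0-va diagonal-0-vb

  sample-X₃ : sample X₃ ≡ false ∷ false ∷ false ∷ true ∷ []
  sample-X₃ = trans (diagonal-sample (pred N) isZero diagonal-pred-va diagonal-pred-vb)
    (cong₂ (λ e z → false ∷ e ∧ z ∷ false ∷ not e ∧ not z ∷ []) even-pred-N ⌊pred[N]/2⌋≢0)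

  sample-X₄ : sample X₄ ≡ false ∷ false ∷ true ∷ false ∷ []
  sample-X₄ = trans (diagonal-sample (pred N) (not ∘ isZero) diagonal-pred-va diagonal-pred-vb)
    (cong₂ (λ e z → false ∷ e ∧ not z ∷ true ∷ not e ∧ not (not z) ∷ []) even-pred-N ⌊pred[N]/2⌋≢0)

  extras-distinct : AllPairs Distinct extras
  extras-distinct =
    (samples-differ X₁ X₂ sample-X₁ sample-X₂ (λ ()) ∷ samples-differ X₁ X₃ sample-X₁ sample-X₃ (λ ()) ∷
     samples-differ X₁ X₄ sample-X₁ sample-X₄ (λ ()) ∷ []) ∷
    (samples-differ X₂ X₃ sample-X₂ sample-X₃ (λ ()) ∷ samples-differ X₂ X₄ sample-X₂ sample-X₄ (λ ()) ∷ []) ∷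
    (samples-differ X₃ X₄ sample-X₃ sample-X₄ (λ ()) ∷ []) ∷ [] ∷ []

  antidiagonal-vs-extras : ∀ o L → All (Distinct (Antidiagonal.matching o L)) extras
  antidiagonal-vs-extras o L =
    unbalanced X₁ sample-X₁ (λ { true _ () ; false _ () }) ∷
    unbalanced X₂ sample-X₂ (λ { true _ () ; false _ () }) ∷
    unbalanced X₃ sample-X₃ (λ { _ true () ; _ false () }) ∷
    unbalanced X₄ sample-X₄ (λ { _ true () ; _ false () }) ∷ []
    where
    unbalanced : ∀ X {s} → sample X ≡ s → Unbalanced s → Distinct (Antidiagonal.matching o L) X
    unbalanced X p u = samples-differ (Antidiagonal.matching o L) X (proj₂ (proj₂ (antidiagonal-sample o L))) p (u _ _)

  tilings : List PerfectMatching
  tilings = map (Antidiagonal.matching 0) (labellings n) ++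
            map (Antidiagonal.matching (pred N)) (labellings n) ++ extras

  tilings-distinct : AllPairs Distinct tilings
  tilings-distinct =
    AllPairsₚ.++⁺ (antidiagonals-distinct 0 z≤n)
      (AllPairsₚ.++⁺ (antidiagonals-distinct (pred N) pred[n]≤n) extras-distinct
        (Allₚ.map⁺ (All.universal (antidiagonal-vs-extras (pred N)) (labellings n))))
      (Allₚ.map⁺ (All.universal (λ L →
        Allₚ.++⁺ (Allₚ.map⁺ (All.universal (antidiagonal-offsets-differ L) (labellings n))) (antidiagonal-vs-extras 0 L)) (labellings n)))
    where
    antidiagonals-distinct : ∀ o → o ≤ N → AllPairs Distinct (map (Antidiagonal.matching o) (labellings n))
    antidiagonals-distinct o o≤N = AllPairsₚ.map⁺ (AllPairs.map (antidiagonal-labels-differ o o≤N) (labellings-differ n))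

  tilings-isolated : All IsolatedInFlipGraph tilings
  tilings-isolated =
    Allₚ.++⁺ (Allₚ.map⁺ (All.universal (Antidiagonal.isolated 0) (labellings n)))
      (Allₚ.++⁺ (Allₚ.map⁺ (All.universal (Antidiagonal.isolated (pred N)) (labellings n)))
        (Diagonal.isolated 0 isZero ∷ Diagonal.isolated 0 (not ∘ isZero) ∷
         Diagonal.isolated (pred N) isZero ∷ Diagonal.isolated (pred N) (not ∘ isZero) ∷ []))

  length-tilings : length tilings ≡ 4 + 2 ^ (n + 1)
  length-tilings = begin
    length (A₀ ++ A₁ ++ extras)              ≡⟨ length-++ A₀ ⟩
    length A₀ + length (A₁ ++ extras)        ≡⟨ cong (length A₀ +_) (length-++ A₁) ⟩
    length A₀ + (length A₁ + 4)              ≡⟨ cong₂ (λ a b → a + (b + 4)) (length-family 0) (length-family (pred N)) ⟩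
    2 ^ n + (2 ^ n + 4)                      ≡⟨ count (2 ^ n) ⟩
    4 + 2 * 2 ^ n                            ≡⟨ cong (λ m → 4 + 2 ^ m) (+-comm 1 n) ⟩
    4 + 2 ^ (n + 1)                          ∎
    where
    A₀ A₁ : List PerfectMatching
    A₀ = map (Antidiagonal.matching 0) (labellings n)
    A₁ = map (Antidiagonal.matching (pred N)) (labellings n)

    length-family : ∀ o → length (map (Antidiagonal.matching o) (labellings n)) ≡ 2 ^ n
    length-family o = trans (length-map (Antidiagonal.matching o) (labellings n)) (length-labellings n)

    count : ∀ x → x + (x + 4) ≡ 4 + 2 * x
    count = solve-∀

proposition4p6 : (n : ℕ) → (h : 2 ≤ n) →
    Σ (List (Torus.PerfectMatching (2 * n) (2 * n) (2 * n) {{2n-nonZero n h}} {{2n-nonZero n h}})) λ ms →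
      AllPairs (Torus.Distinct (2 * n) (2 * n) (2 * n) {{2n-nonZero n h}} {{2n-nonZero n h}}) ms ×
      All (Torus.IsolatedInFlipGraph (2 * n) (2 * n) (2 * n) {{2n-nonZero n h}} {{2n-nonZero n h}}) ms ×
      (4 + 2 ^ (n + 1) ≤ length ms)
proposition4p6 n h = tilings , tilings-distinct , tilings-isolated , ≤-reflexive (sym length-tilings)
  where open EvenSquareTorus n {{2n-nonZero n h}} h
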